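{- Let $n\ge2$, $i\in\{1,\dots,n\}$, $\Gamma$ a finite multiset of $n$PC formulas and $F$ an $n$PC formula. If $\Gamma\models_i F$ then $\Gamma\vdash_i F$ is provable in $n$PC.
   Context: Fix $n\ge 2$, write $\hat n=\{1,\dots,n\}$, let $S_n$ be the group of permutations of $\hat n$ and $V$ a countable set of propositional variables. Formulas of $n$PC are: decorated variables $X^\pi$ ($X\in V$, $\pi\in S_n$); constants $\mathsf e_1,\dots,\mathsf e_n$; compound formulas $q(F,G_1,\dots,G_n)$ with $F,G_1,\dots,G_n$ formulas. For $\rho\in S_n$, $F^\rho$ is defined by $(X^\pi)^\rho=X^{\rho\circ\pi}$, $(\mathsf e_k)^\rho=\mathsf e_{\rho(k)}$, $q(F,G_1,\dots,G_n)^\rho=q(F,G_1^\rho,\dots,G_n^\rho)$ (the first argument is unchanged). $(ij)$ denotes the transposition exchanging $i$ and $j$ (the identity if $i=j$). Contexts $\Gamma,\Delta$ are finite multisets of formulas, $\Gamma^\rho$ is applied elementwise. A sequent is $\Gamma\vdash_i\Delta$ with $i\in\hat n$; it is provable if derivable with the following rules (premises $\Rightarrow$ conclusion), for all $i,j,k\in\hat n$: (Const) $\Rightarrow\ \vdash_i\mathsf e_i$. (Id) $\Rightarrow X^\pi\vdash_i X^\rho$ whenever $\pi^{ -1}(i)=\rho^{ -1}(i)$. (Sym) $\Gamma^{(ij)}\vdash_i\Delta^{(ij)}\Rightarrow\Gamma\vdash_j\Delta$. (Neg1) if $i\ne k$: $\Gamma^{(ij)}\vdash_i F,\Delta^{(ij)}\Rightarrow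 \Gamma,F^{(jk)}\vdash_j\Delta$. (Neg2) if $j\neq k$: $\Gamma^{(ij)}\vdash_i F,\Delta^{(ij)}\Rightarrow \Gamma,F^{(ik)}\vdash_j\Delta$. (Neg3) $\{\Gamma^{(ij)},F\vdash_i\Delta^{(ij)}\}_{i\neq j}\Rightarrow\Gamma\vdash_j F,\Delta$. (qL) $\{\Gamma^{(ji)},F,G_j^{(ji)}\vdash_j\Delta^{(ji)}\}_{j\in\hat n}\Rightarrow \Gamma,q(F,G_1,\dots,G_n)\vdash_i\Delta$. (qR) $\{\Gamma^{(ji)},F\vdash_j G_j^{(ji)},\Delta^{(ji)}\}_{j\in\hat n}\Rightarrow\Gamma\vdash_i q(F,G_1,\dots,G_n),\Delta$. (Cut) $\Gamma,F\vdash_i\Delta$ and $\Gamma\vdash_i F,\Delta\Rightarrow\Gamma\vdash_i\Delta$. Left and right weakening and contraction in each $\vdash_i$. Semantics: an environment is a function $v:V\to\hat n$; $[\![X^\pi]\!]_v=\pi(v(X))$, $[\![\mathsf e_i]\!]_v=i$, $[\![q(F,G_1,\dots,G_n)]\!]_v=[\![G_k]\!]_v$ where $k=[\![F]\!]_v$. $\Gamma\models_i F$ means: for every environment $v$, if $[\![G]\!]_v=i$ for all $G\in\Gamma$ then $[\![F]\!]_v=i$. -}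

module Defs where

open import Data.Nat using (ℕ)
open import Data.Fin using (Fin)
open import Data.Fin.Permutation using (Permutation′; _⟨$⟩ʳ_; _⟨$⟩ˡ_; _∘ₚ_; transpose)
open import Data.List using (List; []; _∷_; map)
open import Data.List.Relation.Unary.All using (All)
open import Data.List.Relation.Binary.Permutation.Propositional using (_↭_)
open import Relation.Binary.PropositionalEquality using (_≡_; _≢_)

Var : Set
Var = ℕ

-- The index set \hat n is represented by Fin n (k ↦ k+1).
-- Formulas of nPC.
data Formula (n : ℕ) : Set where
  var : Var → Permutation′ n → Formula n
  e   : Fin n → Formula n
  q   : Formula n → (Fin n → Formula n) → Formula n

-- Action F^ρ.   (X^π)^ρ = X^(ρ∘π);  ρ∘π (apply π first) is  π ∘ₚ ρ  in stdlib.
_^_ : ∀ {n} → Formula n → Permutation′ n → Formula n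
var X π ^ ρ = var X (π ∘ₚ ρ)
e k ^ ρ = e (ρ ⟨$⟩ʳ k)
q F G ^ ρ = q F (λ k → G k ^ ρ)

τ : ∀ {n} → Fin n → Fin n → Permutation′ n
τ i j = transpose i j

-- Contexts: finite multisets, represented as lists up to permutation
-- (the exchange rule below makes derivability invariant under reordering).
Ctx : ℕ → Set
Ctx n = List (Formula n)

_^ᶜ_ : ∀ {n} → Ctx n → Permutation′ n → Ctx n
Γ ^ᶜ ρ = map (_^ ρ) Γ

infix 4 _⊢[_]_
data _⊢[_]_ {n : ℕ} : Ctx n → Fin n → Ctx n → Set where
  const : ∀ {i} → [] ⊢[ i ] (e i ∷ [])
  ax    : ∀ {i} X (π ρ : Permutation′ n) → π ⟨$⟩ˡ i ≡ ρ ⟨$⟩ˡ i →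
          (var X π ∷ []) ⊢[ i ] (var X ρ ∷ [])
  sym   : ∀ {i j Γ Δ} → (Γ ^ᶜ τ i j) ⊢[ i ] (Δ ^ᶜ τ i j) → Γ ⊢[ j ] Δ
  neg1  : ∀ {i j k Γ Δ F} → i ≢ k →
          (Γ ^ᶜ τ i j) ⊢[ i ] (F ∷ (Δ ^ᶜ τ i j)) → ((F ^ τ j k) ∷ Γ) ⊢[ j ] Δ
  neg2  : ∀ {i j k Γ Δ F} → j ≢ k →
          (Γ ^ᶜ τ i j) ⊢[ i ] (F ∷ (Δ ^ᶜ τ i j)) → ((F ^ τ i k) ∷ Γ) ⊢[ j ] Δ
  neg3  : ∀ {j Γ Δ F} →
          (∀ i → i ≢ j → (F ∷ (Γ ^ᶜ τ i j)) ⊢[ i ] (Δ ^ᶜ τ i j)) →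
          Γ ⊢[ j ] (F ∷ Δ)
  qL    : ∀ {i Γ Δ F G} →
          (∀ j → (F ∷ (G j ^ τ j i) ∷ (Γ ^ᶜ τ j i)) ⊢[ j ] (Δ ^ᶜ τ j i)) →
          (q F G ∷ Γ) ⊢[ i ] Δ
  qR    : ∀ {i Γ Δ F G} →
          (∀ j → (F ∷ (Γ ^ᶜ τ j i)) ⊢[ j ] ((G j ^ τ j i) ∷ (Δ ^ᶜ τ j i))) →
          Γ ⊢[ i ] (q F G ∷ Δ)
  cut   : ∀ {i Γ Δ F} → (F ∷ Γ) ⊢[ i ] Δ → Γ ⊢[ i ] (F ∷ Δ) → Γ ⊢[ i ] Δ
  wL    : ∀ {i Γ Δ F} → Γ ⊢[ i ] Δ → (F ∷ Γ) ⊢[ i ] Δ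
  wR    : ∀ {i Γ Δ F} → Γ ⊢[ i ] Δ → Γ ⊢[ i ] (F ∷ Δ)
  cL    : ∀ {i Γ Δ F} → (F ∷ F ∷ Γ) ⊢[ i ] Δ → (F ∷ Γ) ⊢[ i ] Δ
  cR    : ∀ {i Γ Δ F} → Γ ⊢[ i ] (F ∷ F ∷ Δ) → Γ ⊢[ i ] (F ∷ Δ)
  exch  : ∀ {i Γ Γ′ Δ Δ′} → Γ ↭ Γ′ → Δ ↭ Δ′ → Γ ⊢[ i ] Δ → Γ′ ⊢[ i ] Δ′

Env : ℕ → Set
Env n = Var → Fin n

⟦_⟧ : ∀ {n} → Formula n → Env n → Fin n
⟦ var X π ⟧ v = π ⟨$⟩ʳ v X
⟦ e k ⟧ v = k
⟦ q F G ⟧ v = ⟦ G (⟦ F ⟧ v) ⟧ v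

_⊨[_]_ : ∀ {n} → Ctx n → Fin n → Formula n → Set
Γ ⊨[ i ] F = ∀ v → All (λ G → ⟦ G ⟧ v ≡ i) Γ → ⟦ F ⟧ v ≡ i

-- Neg3 moves F to the left, so it suffices that every context Γ unsatisfiable at i
-- proves Γ ⊢ᵢ (empty).  qL is semantically invertible and strictly lowers the total
-- weight of the context, so by well-founded induction only atomic contexts remain.
-- An unsatisfiable atomic context contains a constant eₖ with k ≠ i, or atoms X^π and
-- X^ρ with π⁻¹(i) ≠ ρ⁻¹(i), and both are refuted by Neg1; otherwise sending X to
-- π⁻¹(i) for an occurrence X^π in Γ is a model.

module Submission where

open import Defs
open import Data.Nat using (ℕ; _≤_)
open import Data.Fin using (Fin)
open import Data.List using ([]; _∷_)

open import Data.Empty using (⊥-elim)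
open import Data.Fin.Permutation using (Permutation′; _⟨$⟩ʳ_; _⟨$⟩ˡ_; _∘ₚ_; inverseˡ; inverseʳ)
import Data.Fin.Permutation.Components as PC
open import Data.Fin.Properties using (_≟_)
open import Data.List using (_++_; map)
open import Data.List.Membership.Propositional using (_∈_; find; lose)
open import Data.List.Membership.Propositional.Properties using (∈-∃++; ∈-map⁺)
open import Data.List.Properties using (map-∘; map-cong)
open import Data.List.Relation.Binary.Permutation.Propositional using (_↭_; ↭-refl; ↭-sym; ↭-swap)
open import Data.List.Relation.Binary.Permutation.Propositional.Properties
  using (++-comm; shift; ∈-resp-↭; All-resp-↭; map⁺)
open import Data.List.Relation.Unary.All as All using (All; _∷_)
open import Data.List.Relation.Unary.All.Properties using (map⁻; ¬Any⇒All¬)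
open import Data.List.Relation.Unary.Any using (here; there; any?)
open import Data.Nat using (_+_; _<_; suc) renaming (_≟_ to _≟ℕ_)
open import Data.Nat.Induction using (<-wellFounded)
import Data.Nat.ListAction as List
open import Data.Nat.ListAction.Properties using (sum-↭)
open import Data.Nat.Properties
  using ( m≤m+n; ≤-reflexive; ≤-trans; +-assoc; +-monoʳ-≤; +-monoˡ-≤; n<1+n
        ; +-0-commutativeMonoid; module ≤-Reasoning)
open import Algebra.Properties.CommutativeMonoid.Sum +-0-commutativeMonoid
  using (sum; sum-cong-≗; sum-remove)
open import Data.Product using (∃; _×_; _,_; map₁; map₂)
open import Function using (_∘_)
open import Induction.WellFounded using (Acc; acc)
open import Relation.Binary.PropositionalEquality as ≡
  using (_≡_; _≢_; refl; trans; cong; cong₂; subst; module ≡-Reasoning)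
open import Relation.Nullary using (¬_; Dec; yes; no; contradiction)
open import Relation.Nullary.Decidable using (dec-true; dec-false; decidable-stable; map′; ¬?)

private variable
  n : ℕ
  i j k : Fin n
  X : Var
  π ρ : Permutation′ n
  F G H : Formula n
  Γ Δ : Ctx n

transpose-same : (i k : Fin n) → PC.transpose i i k ≡ k
transpose-same i k with k ≟ i
... | yes k≡i = ≡.sym k≡i
... | no k≢i rewrite dec-false (k ≟ i) k≢i = refl

transpose-matchʳ : (i j : Fin n) → PC.transpose i j j ≡ i
transpose-matchʳ i j with j ≟ i
... | yes j≡i = j≡i
... | no _ rewrite dec-true (j ≟ j) refl = refl

⟦^⟧ : (F : Formula n) (ρ : Permutation′ n) (v : Env n) → ⟦ F ^ ρ ⟧ v ≡ ρ ⟨$⟩ʳ ⟦ F ⟧ v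
⟦^⟧ (var X π) ρ v = refl
⟦^⟧ (e k) ρ v = refl
⟦^⟧ (q F G) ρ v = ⟦^⟧ (G (⟦ F ⟧ v)) ρ v

⟦^τ⟧-reflects : ∀ v → ⟦ G ^ τ j i ⟧ v ≡ j → ⟦ G ⟧ v ≡ i
⟦^τ⟧-reflects {G = G} {j = j} {i = i} v G^τ≡j = begin
  ⟦ G ⟧ v                             ≡⟨ inverseˡ (τ j i) ⟨
  τ j i ⟨$⟩ˡ (τ j i ⟨$⟩ʳ ⟦ G ⟧ v)    ≡⟨ cong (τ j i ⟨$⟩ˡ_) (trans (≡.sym (⟦^⟧ G (τ j i) v)) G^τ≡j) ⟩
  τ j i ⟨$⟩ˡ j                        ≡⟨ transpose-matchʳ i j ⟩
  i                                   ∎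
  where open ≡-Reasoning

Holds : Env n → Fin n → Ctx n → Set
Holds v i Γ = All (λ G → ⟦ G ⟧ v ≡ i) Γ

Unsatisfiable : Fin n → Ctx n → Set
Unsatisfiable i Γ = ∀ v → ¬ Holds v i Γ

Holds-^τ-reflects : ∀ {v} → Holds v j (Γ ^ᶜ τ j i) → Holds v i Γ
Holds-^τ-reflects {v = v} = All.map (λ {G} → ⟦^τ⟧-reflects {G = G} v) ∘ map⁻

weakenˡ : ∀ Γ′ → Γ ⊢[ i ] Δ → (Γ ++ Γ′) ⊢[ i ] Δ
weakenˡ {Γ = Γ} {i = i} {Δ = Δ} Γ′ Γ⊢Δ = exch (++-comm Γ′ Γ) ↭-refl (prepend Γ′)
  where
  prepend : ∀ Γ′ → (Γ′ ++ Γ) ⊢[ i ] Δ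
  prepend [] = Γ⊢Δ
  prepend (_ ∷ Γ′) = wL (prepend Γ′)

weakenʳ : ∀ Δ′ → Γ ⊢[ i ] Δ → Γ ⊢[ i ] (Δ ++ Δ′)
weakenʳ {Γ = Γ} {i = i} {Δ = Δ} Δ′ Γ⊢Δ = exch ↭-refl (++-comm Δ′ Δ) (prepend Δ′)
  where
  prepend : ∀ Δ′ → Γ ⊢[ i ] (Δ′ ++ Δ)
  prepend [] = Γ⊢Δ
  prepend (_ ∷ Δ′) = wR (prepend Δ′)

∈⇒↭ : ∀ {A : Set} {x : A} {xs} → x ∈ xs → ∃ λ ys → xs ↭ x ∷ ys
∈⇒↭ x∈xs with ∈-∃++ x∈xs
... | ys , zs , refl = ys ++ zs , shift _ ys zs

∈-weakenˡ : G ∈ Γ → (G ∷ []) ⊢[ i ] Δ → Γ ⊢[ i ] Δ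
∈-weakenˡ G∈Γ G⊢Δ with ∈⇒↭ G∈Γ
... | Γ′ , Γ↭ = exch (↭-sym Γ↭) ↭-refl (weakenˡ Γ′ G⊢Δ)

replaceˡ : (G ∷ []) ⊢[ i ] (H ∷ []) → (H ∷ Γ) ⊢[ i ] Δ → (G ∷ Γ) ⊢[ i ] Δ
replaceˡ {G = G} {H = H} {Γ = Γ} {Δ = Δ} G⊢H H,Γ⊢Δ =
  cut (exch (↭-swap G H ↭-refl) ↭-refl (wL H,Γ⊢Δ)) (weakenʳ Δ (weakenˡ Γ G⊢H))

constant-refutes : e k ∈ Γ → k ≢ i → Γ ⊢[ i ] []
constant-refutes {k = k} {i = i} e∈Γ k≢i with ∈⇒↭ e∈Γ
... | Γ′ , Γ↭ = exch (↭-sym Γ↭) ↭-refl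
  (subst (λ m → (e m ∷ Γ′) ⊢[ i ] []) (transpose-same i k)
    (neg1 {i = k} {j = i} {k = i} k≢i (weakenˡ (Γ′ ^ᶜ τ k i) const)))

clash-refutes : var X π ∈ Γ → var X ρ ∈ Γ → π ⟨$⟩ˡ i ≢ ρ ⟨$⟩ˡ i → Γ ⊢[ i ] []
clash-refutes {X = X} {π = π} {ρ = ρ} {i = i} X^π∈Γ X^ρ∈Γ differ with ∈⇒↭ X^ρ∈Γ
... | Γ′ , Γ↭ = exch (↭-sym Γ↭) ↭-refl
  -- Neg1 yields X^(ρ ∘ (i i)), which is only provably, not definitionally, X^ρ.
  (replaceˡ (ax X ρ (ρ ∘ₚ τ i i) (cong (ρ ⟨$⟩ˡ_) (≡.sym (transpose-same i i))))
    (neg1 {i = c} {j = i} {k = i} c≢i premise))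
  where
  c : Fin _
  c = ρ ⟨$⟩ʳ (π ⟨$⟩ˡ i)
  c≢i : c ≢ i
  c≢i c≡i = differ (trans (≡.sym (inverseˡ ρ)) (cong (ρ ⟨$⟩ˡ_) c≡i))
  X^π∈Γ′ : var X π ∈ Γ′
  X^π∈Γ′ with ∈-resp-↭ Γ↭ X^π∈Γ
  ... | here refl = ⊥-elim (differ refl)
  ... | there X^π∈Γ′ = X^π∈Γ′
  premise : (Γ′ ^ᶜ τ c i) ⊢[ c ] (var X ρ ∷ [])
  premise = ∈-weakenˡ (∈-map⁺ (_^ τ c i) X^π∈Γ′)
    (ax X (π ∘ₚ τ c i) ρ (trans (cong (π ⟨$⟩ˡ_) (transpose-matchʳ i c)) (≡.sym (inverseˡ ρ))))

-- The atoms G and H never both evaluate to i (a wrong constant conflicts with itself).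
data Conflict (i : Fin n) : Formula n → Formula n → Set where
  wrong-constant : k ≢ i → Conflict i (e k) (e k)
  clash : π ⟨$⟩ˡ i ≢ ρ ⟨$⟩ˡ i → Conflict i (var X π) (var X ρ)

conflict? : (i : Fin n) (G H : Formula n) → Dec (Conflict i G H)
conflict? i (e k) (e m) with k ≟ m
... | no k≢m = no λ { (wrong-constant _) → k≢m refl }
... | yes refl = map′ wrong-constant (λ { (wrong-constant k≢i) → k≢i }) (¬? (k ≟ i))
conflict? i (var X π) (var Y ρ) with X ≟ℕ Y
... | no X≢Y = no λ { (clash _) → X≢Y refl }
... | yes refl = map′ clash (λ { (clash differ) → differ }) (¬? (π ⟨$⟩ˡ i ≟ ρ ⟨$⟩ˡ i))
conflict? i (e _) (var _ _) = no λ ()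
conflict? i (e _) (q _ _) = no λ ()
conflict? i (var _ _) (e _) = no λ ()
conflict? i (var _ _) (q _ _) = no λ ()
conflict? i (q _ _) _ = no λ ()

conflict-refutes : G ∈ Γ → H ∈ Γ → Conflict i G H → Γ ⊢[ i ] []
conflict-refutes e∈Γ _ (wrong-constant k≢i) = constant-refutes e∈Γ k≢i
conflict-refutes X^π∈Γ X^ρ∈Γ (clash differ) = clash-refutes X^π∈Γ X^ρ∈Γ differ

data IsCompound {n} : Formula n → Set where
  compound : ∀ F G → IsCompound (q F G)

isCompound? : (G : Formula n) → Dec (IsCompound G)
isCompound? (var _ _) = no λ ()
isCompound? (e _) = no λ ()
isCompound? (q F G) = yes (compound F G)

-- The countermodel: X takes the value forced by its first occurrence X^π in Γ.
pin : Fin n → Ctx n → Env n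
pin i [] X = i
pin i (var Y π ∷ Γ) X with Y ≟ℕ X
... | yes _ = π ⟨$⟩ˡ i
... | no _ = pin i Γ X
pin i (_ ∷ Γ) X = pin i Γ X

pin-pinned : var X π ∈ Γ → ∃ λ ρ → var X ρ ∈ Γ × pin i Γ X ≡ ρ ⟨$⟩ˡ i
pin-pinned {X = X} {Γ = var Y ρ ∷ Γ} X^π∈Γ with Y ≟ℕ X | X^π∈Γ
... | yes refl | _ = ρ , here refl , refl
... | no Y≢X | here refl = ⊥-elim (Y≢X refl)
... | no _ | there X^π∈Γ′ = map₂ (map₁ there) (pin-pinned X^π∈Γ′)
pin-pinned {Γ = e _ ∷ Γ} (there X^π∈Γ) = map₂ (map₁ there) (pin-pinned X^π∈Γ)
pin-pinned {Γ = q _ _ ∷ Γ} (there X^π∈Γ) = map₂ (map₁ there) (pin-pinned X^π∈Γ)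

pin-holds : All (¬_ ∘ IsCompound) Γ → (∀ {G H} → G ∈ Γ → H ∈ Γ → ¬ Conflict i G H) →
            Holds (pin i Γ) i Γ
pin-holds {Γ = Γ} {i = i} atomic consistent = All.tabulate holds
  where
  holds : G ∈ Γ → ⟦ G ⟧ (pin i Γ) ≡ i
  holds {e k} e∈Γ = decidable-stable (k ≟ i) (consistent e∈Γ e∈Γ ∘ wrong-constant)
  holds {q F G} q∈Γ = ⊥-elim (All.lookup atomic q∈Γ (compound F G))
  holds {var X π} X^π∈Γ with pin-pinned {i = i} X^π∈Γ
  ... | ρ , X^ρ∈Γ , pinned = begin
    π ⟨$⟩ʳ pin i Γ X     ≡⟨ cong (π ⟨$⟩ʳ_) pinned ⟩
    π ⟨$⟩ʳ (ρ ⟨$⟩ˡ i)    ≡⟨ cong (π ⟨$⟩ʳ_) agree ⟨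
    π ⟨$⟩ʳ (π ⟨$⟩ˡ i)    ≡⟨ inverseʳ π ⟩
    i                    ∎
    where
    open ≡-Reasoning
    agree : π ⟨$⟩ˡ i ≡ ρ ⟨$⟩ˡ i
    agree = decidable-stable (π ⟨$⟩ˡ i ≟ ρ ⟨$⟩ˡ i) (consistent X^π∈Γ X^ρ∈Γ ∘ clash)

refute-atomic : All (¬_ ∘ IsCompound) Γ → Unsatisfiable i Γ → Γ ⊢[ i ] []
refute-atomic {Γ = Γ} {i = i} atomic unsat with any? (λ G → any? (conflict? i G) Γ) Γ
... | yes conflicting with find conflicting
...   | G , G∈Γ , G-conflicts with find G-conflicts
...     | H , H∈Γ , conflict = conflict-refutes G∈Γ H∈Γ conflict
refute-atomic {Γ = Γ} {i = i} atomic unsat | no consistent =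
  contradiction (pin-holds atomic λ G∈Γ H∈Γ conflict → consistent (lose G∈Γ (lose H∈Γ conflict)))
                (unsat (pin i Γ))

weight : Formula n → ℕ
weight (var _ _) = 0
weight (e _) = 0
weight (q F G) = suc (weight F + sum (λ k → weight (G k)))

weight-^ : (F : Formula n) (ρ : Permutation′ n) → weight (F ^ ρ) ≡ weight F
weight-^ (var _ _) ρ = refl
weight-^ (e _) ρ = refl
weight-^ (q F G) ρ = cong (λ s → suc (weight F + s)) (sum-cong-≗ (λ k → weight-^ (G k) ρ))

weightᶜ : Ctx n → ℕ
weightᶜ Γ = List.sum (map weight Γ)

weightᶜ-^ᶜ : (Γ : Ctx n) (ρ : Permutation′ n) → weightᶜ (Γ ^ᶜ ρ) ≡ weightᶜ Γ
weightᶜ-^ᶜ Γ ρ = cong List.sum (trans (≡.sym (map-∘ Γ)) (map-cong (λ G → weight-^ G ρ) Γ))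

weightᶜ-↭ : Γ ↭ Δ → weightᶜ Γ ≡ weightᶜ Δ
weightᶜ-↭ = sum-↭ ∘ map⁺ weight

≤-sum : ∀ {n} (t : Fin n → ℕ) (k : Fin n) → t k ≤ sum t
≤-sum {n = suc _} t k = ≤-trans (m≤m+n (t k) _) (≤-reflexive (≡.sym (sum-remove {i = k} t)))

qL-decreases : ∀ (G : Fin n → Formula n) Γ j (ρ : Permutation′ n) →
               weightᶜ (F ∷ (G j ^ ρ) ∷ (Γ ^ᶜ ρ)) < weightᶜ (q F G ∷ Γ)
qL-decreases {F = F} G Γ j ρ = begin-strict
  weight F + (weight (G j ^ ρ) + weightᶜ (Γ ^ᶜ ρ))
    ≡⟨ cong (weight F +_) (cong₂ _+_ (weight-^ (G j) ρ) (weightᶜ-^ᶜ Γ ρ)) ⟩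
  weight F + (weight (G j) + weightᶜ Γ)
    ≤⟨ +-monoʳ-≤ (weight F) (+-monoˡ-≤ (weightᶜ Γ) (≤-sum _ j)) ⟩
  weight F + (∑G + weightᶜ Γ)
    ≡⟨ +-assoc (weight F) ∑G (weightᶜ Γ) ⟨
  weight F + ∑G + weightᶜ Γ
    <⟨ n<1+n _ ⟩
  weightᶜ (q F G ∷ Γ)
    ∎
  where
  open ≤-Reasoning
  ∑G = sum (λ k → weight (G k))

qL-inverts : {G : Fin n → Formula n} → Unsatisfiable i (q F G ∷ Γ) →
             ∀ j → Unsatisfiable j (F ∷ (G j ^ τ j i) ∷ (Γ ^ᶜ τ j i))
qL-inverts {i = i} {F = F} {G = G} unsat j v (F≡j ∷ G^τ≡j ∷ Γ^τ≡j) =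
  unsat v (q-holds ∷ Holds-^τ-reflects Γ^τ≡j)
  where
  q-holds : ⟦ q F G ⟧ v ≡ i
  q-holds = subst (λ k → ⟦ G k ⟧ v ≡ i) (≡.sym F≡j) (⟦^τ⟧-reflects {G = G j} v G^τ≡j)

refute-acc : Acc _<_ (weightᶜ Γ) → Unsatisfiable i Γ → Γ ⊢[ i ] []
refute-acc {Γ = Γ} (acc smaller) unsat with any? isCompound? Γ
... | no atomic = refute-atomic (¬Any⇒All¬ Γ atomic) unsat
... | yes has-compound with find has-compound
...   | _ , q∈Γ , compound F G with ∈⇒↭ q∈Γ
...     | Γ′ , Γ↭ = exch (↭-sym Γ↭) ↭-refl (qL λ j →
  refute-acc (smaller (subst (_ <_) (≡.sym (weightᶜ-↭ Γ↭)) (qL-decreases G Γ′ j _)))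
             (qL-inverts (λ v → unsat v ∘ All-resp-↭ (↭-sym Γ↭)) j))

refute : Unsatisfiable i Γ → Γ ⊢[ i ] []
refute = refute-acc (<-wellFounded _)

proposition4p10 : (n : ℕ) → 2 ≤ n → (i : Fin n) (Γ : Ctx n) (F : Formula n) →
                    Γ ⊨[ i ] F → Γ ⊢[ i ] (F ∷ [])
proposition4p10 n _ i Γ F Γ⊨F = neg3 λ j j≢i → refute λ { v (F≡j ∷ Γ^τ≡j) →
  j≢i (trans (≡.sym F≡j) (Γ⊨F v (Holds-^τ-reflects Γ^τ≡j))) }
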